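{- Let $\mathsf{LJpm}$ be the multi-succedent sequent calculus for intuitionistic propositional logic described in the context. Then: (1) every intuitionistically valid sequent $\Gamma\Rightarrow\Delta$ is derivable in $\mathsf{LJpm}$ (completeness with respect to Kripke semantics); and (2) $\mathsf{LJpm}$ admits the Hauptsatz, i.e. the cut rule $$\frac{\Gamma\Rightarrow\alpha,\Delta\qquad \Gamma,\alpha\Rightarrow\Delta}{\Gamma\Rightarrow\Delta}$$ is admissible: if both premises are derivable in $\mathsf{LJpm}$, so is the conclusion.
   Context: Formulas are built from propositional variables (atoms) $p,q,r,\dots$ and $\bot$ using $\lor,\land,\supset$; $Atm$ is the set of atoms. Cedents are finite sets of formulas; a sequent is a pair $\Gamma\Rightarrow\Delta$ of cedents. The calculus $\mathsf{LJpm}$ has axioms: $\Gamma\Rightarrow\Delta$ whenever $\Gamma\cap\Delta\cap Atm\neq\emptyset$, and $\Gamma\Rightarrow\Delta$ whenever $\bot\in\Gamma$. Its inference rules (the principal formula stays in the lower sequent and is retained in the premises): $(\lor\Rightarrow)$: from $\alpha_0,\Gamma\Rightarrow\Delta$ and $\alpha_1,\Gamma\Rightarrow\Delta$ infer $\Gamma\Rightarrow\Delta$, where $\alpha_0\lor\alpha_1\in\Gamma$; $(\Rightarrow\lor)$: from $\Delta\Rightarrow\Gamma,\alpha_0,\alpha_1$ infer $\Delta\Rightarrow\Gamma$, where $\alpha_0\lor\alpha_1\in\Gamma$; $(\land\Rightarrow)$: from $\alpha_0,\alpha_1,\Gamma\Rightarrow\Delta$ infer $\Gamma\Rightarrow\Delta$,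 where $\alpha_0\land\alpha_1\in\Gamma$; $(\Rightarrow\land)$: from $\Delta\Rightarrow\Gamma,\alpha_0$ and $\Delta\Rightarrow\Gamma,\alpha_1$ infer $\Delta\Rightarrow\Gamma$, where $\alpha_0\land\alpha_1\in\Gamma$; $(\supset\Rightarrow)$: from $\Gamma\Rightarrow\Delta,\alpha$ and $\beta,\Gamma\Rightarrow\Delta$ infer $\Gamma\Rightarrow\Delta$, where $\alpha\supset\beta\in\Gamma$; $(\Rightarrow\supset)$: from $\alpha,\Delta\Rightarrow\beta$ infer $\Delta\Rightarrow\Gamma$, where $\alpha\supset\beta\in\Gamma$ (the succedent of the premise is the single formula $\beta$). Derivations are finite trees built from these rules whose leaves are axioms; there is no cut rule in $\mathsf{LJpm}$. A Kripke model is $\langle W,\preceq,V\rangle$ with $W\neq\emptyset$, $\preceq$ a reflexive transitive relation on $W$, and $V:W\to\mathcal P(Atm)$ with $V(\sigma)\subseteq V(\tau)$ whenever $\sigma\preceq\tau$. Forcing: $\sigma\models p$ iff $p\in V(\sigma)$; $\sigma\not\models\bot$; $\lor,\land$ pointwise; $\sigma\models\alpha\supset\beta$ iff for all $\tau\succeq\sigma$, $\tau\models\alpha$ implies $\tau\models\beta$. A sequent $\Gamma\Rightarrow\Delta$ is intuitionistically valid if for every Kripke model and every world $\sigma$, $\sigma\models\bigwedge\Gamma$ implies $\sigma\models\bigvee\Delta$. -}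

module Defs where

open import Data.Nat using (ℕ)
open import Data.List using (List; []; _∷_)
open import Data.List.Membership.Propositional using (_∈_)
open import Data.List.Relation.Unary.All using (All)
open import Data.List.Relation.Unary.Any using (Any)
open import Data.Empty using (⊥)
open import Data.Product using (_×_)
open import Data.Sum using (_⊎_)
open import Level using (suc; zero)

Atm : Set
Atm = ℕ

infixr 6 _∧′_
infixr 5 _∨′_
infixr 4 _⊃_

data Formula : Set where
  atom : Atm → Formula
  ⊥′   : Formula
  _∨′_ : Formula → Formula → Formula
  _∧′_ : Formula → Formula → Formula
  _⊃_  : Formula → Formula → Formula

-- Cedents: finite sets of formulas, represented as lists; all rules and
-- axioms only use membership, "α , Γ" is α ∷ Γ.
Cedent : Set
Cedent = List Formula

-- The calculus LJpm (principal formula retained in the premises).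
infix 3 _⇒_
data _⇒_ : Cedent → Cedent → Set where
  ax   : ∀ {Γ Δ} p → atom p ∈ Γ → atom p ∈ Δ → Γ ⇒ Δ
  ⊥ax  : ∀ {Γ Δ} → ⊥′ ∈ Γ → Γ ⇒ Δ
  ∨L   : ∀ {Γ Δ α₀ α₁} → (α₀ ∨′ α₁) ∈ Γ →
         α₀ ∷ Γ ⇒ Δ → α₁ ∷ Γ ⇒ Δ → Γ ⇒ Δ
  ∨R   : ∀ {Γ Δ α₀ α₁} → (α₀ ∨′ α₁) ∈ Δ →
         Γ ⇒ α₀ ∷ α₁ ∷ Δ → Γ ⇒ Δ
  ∧L   : ∀ {Γ Δ α₀ α₁} → (α₀ ∧′ α₁) ∈ Γ →
         α₀ ∷ α₁ ∷ Γ ⇒ Δ → Γ ⇒ Δ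
  ∧R   : ∀ {Γ Δ α₀ α₁} → (α₀ ∧′ α₁) ∈ Δ →
         Γ ⇒ α₀ ∷ Δ → Γ ⇒ α₁ ∷ Δ → Γ ⇒ Δ
  ⊃L   : ∀ {Γ Δ α β} → (α ⊃ β) ∈ Γ →
         Γ ⇒ α ∷ Δ → β ∷ Γ ⇒ Δ → Γ ⇒ Δ
  ⊃R   : ∀ {Γ Δ α β} → (α ⊃ β) ∈ Δ →
         α ∷ Γ ⇒ β ∷ [] → Γ ⇒ Δ

record KripkeModel : Set₁ where
  field
    W        : Set
    inhabited : W
    _≼_      : W → W → Set
    ≼-refl   : ∀ {σ} → σ ≼ σ
    ≼-trans  : ∀ {σ τ υ} → σ ≼ τ → τ ≼ υ → σ ≼ υ
    V        : W → Atm → Set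
    V-mono   : ∀ {σ τ p} → σ ≼ τ → V σ p → V τ p

module _ (M : KripkeModel) where
  open KripkeModel M

  infix 2 _⊩_
  _⊩_ : W → Formula → Set
  σ ⊩ atom p  = V σ p
  σ ⊩ ⊥′      = ⊥
  σ ⊩ (α ∨′ β) = (σ ⊩ α) ⊎ (σ ⊩ β)
  σ ⊩ (α ∧′ β) = (σ ⊩ α) × (σ ⊩ β)
  σ ⊩ (α ⊃ β)  = ∀ τ → σ ≼ τ → τ ⊩ α → τ ⊩ β

-- σ ⊩ ⋀Γ is All (σ ⊩_) Γ ;  σ ⊩ ⋁Δ is Any (σ ⊩_) Δ  (empty ⋁ = ⊥).
Valid : Cedent → Cedent → Set₁
Valid Γ Δ = (M : KripkeModel) (σ : KripkeModel.W M) →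
            All (_⊩_ M σ) Γ → Any (_⊩_ M σ) Δ

module Submission where

-- For completeness we follow
-- the classical canonical-model argument, made constructive by finiteness.
-- Fix a finite set S of formulas closed under immediate subformulas and
-- containing Γ, Δ.
--   * Derivability of sequents over S is decidable: stratify derivations by
--     height; the heights give an increasing chain of decidable relations on
--     the finitely many sequents over S (up to ⊆), which must stabilise, and
--     the stable level already contains every derivable sequent over S.
--   * Every underivable sequent over S extends to a saturated underivable one
--     (each unsatisfied rule has an underivable premise that adds a new formula
--     of S; the number of missing formulas of S decreases).
--   * The saturated underivable sequents over S, ordered by inclusion of
--     antecedents, form a Kripke model in which every world forces its
--     antecedent and no formula of its succedent (truth lemma).
-- Hence an underivable Γ ⇒ Δ is refuted, i.e. valid sequents are derivable.
-- Cut is then admissible semantically: both premises are sound, so the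
-- conclusion is valid, hence derivable by completeness.

open import Defs
open import Data.Nat using (ℕ; zero; suc; _+_; _≤_; _<_; z≤n; s≤s; _⊔_)
import Data.Nat as ℕ
open import Data.Nat.Properties
  using (≤-refl; ≤-trans; n≤1+n; m≤n⇒m≤1+n; 1+n≰n; ≤-<-trans; m≤m⊔n; m≤n⊔m; +-mono-<-≤; +-mono-≤-<)
open import Data.Nat.Induction using (<-wellFounded)
open import Induction.WellFounded using (Acc; acc)
open import Data.List using (List; []; _∷_; _++_; map; length; filter; cartesianProduct)
open import Data.List.Membership.Propositional using (_∈_; _∉_; lose; find)
open import Data.List.Membership.Propositional.Properties
  using (∈-++⁺ˡ; ∈-++⁺ʳ; ∈-++⁻; ∈-map⁺; ∈-filter⁺; ∈-filter⁻; ∈-cartesianProduct⁺)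
open import Data.List.Relation.Binary.Subset.Propositional using (_⊆_)
open import Data.List.Relation.Binary.Subset.Propositional.Properties
  using (⊆-refl; ⊆-trans; ∷⁺ʳ; ∈-∷⁺ʳ; xs⊆ys++xs; Any-resp-⊆)
open import Data.List.Relation.Unary.All as All using (All; []; _∷_; all?)
open import Data.List.Relation.Unary.All.Properties using (¬All⇒Any¬)
open import Data.List.Relation.Unary.Any as Any using (Any; here; there; any?)
open import Data.Product using (_×_; _,_; proj₁; proj₂; Σ)
open import Data.Sum using (_⊎_; inj₁; inj₂; [_,_])
open import Data.Empty using (⊥; ⊥-elim)
open import Data.Unit using (⊤; tt)
open import Data.Bool using (true; false)
open import Function using (_∘_)
open import Relation.Nullary using (¬_; Dec; yes; no; does)
open import Relation.Nullary.Decidable using (_×-dec_; _⊎-dec_; _→-dec_; ¬?)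
open import Relation.Unary using (Decidable)
open import Relation.Binary.PropositionalEquality using (_≡_; refl; subst)

binary? : {f : Formula → Formula → Formula} →
          (∀ {a b c d} → f a b ≡ f c d → a ≡ c × b ≡ d) →
          ∀ {a b c d} → Dec (a ≡ c) → Dec (b ≡ d) → Dec (f a b ≡ f c d)
binary? inj (yes refl) (yes refl) = yes refl
binary? inj (no a≢c)   _          = no (a≢c ∘ proj₁ ∘ inj)
binary? inj (yes _)    (no b≢d)   = no (b≢d ∘ proj₂ ∘ inj)

infix 4 _≟F_
_≟F_ : (φ ψ : Formula) → Dec (φ ≡ ψ)
atom p ≟F atom q with p ℕ.≟ q
... | yes refl = yes refl
... | no p≢q   = no λ { refl → p≢q refl }
⊥′ ≟F ⊥′ = yes refl
(a ∨′ b) ≟F (c ∨′ d) = binary? (λ { refl → refl , refl }) (a ≟F c) (b ≟F d)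
(a ∧′ b) ≟F (c ∧′ d) = binary? (λ { refl → refl , refl }) (a ≟F c) (b ≟F d)
(a ⊃ b)  ≟F (c ⊃ d)  = binary? (λ { refl → refl , refl }) (a ≟F c) (b ≟F d)
atom _ ≟F ⊥′      = no λ ()
atom _ ≟F (_ ∨′ _) = no λ ()
atom _ ≟F (_ ∧′ _) = no λ ()
atom _ ≟F (_ ⊃ _)  = no λ ()
⊥′ ≟F atom _      = no λ ()
⊥′ ≟F (_ ∨′ _)    = no λ ()
⊥′ ≟F (_ ∧′ _)    = no λ ()
⊥′ ≟F (_ ⊃ _)     = no λ ()
(_ ∨′ _) ≟F atom _   = no λ ()
(_ ∨′ _) ≟F ⊥′       = no λ ()
(_ ∨′ _) ≟F (_ ∧′ _) = no λ ()
(_ ∨′ _) ≟F (_ ⊃ _)  = no λ ()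
(_ ∧′ _) ≟F atom _   = no λ ()
(_ ∧′ _) ≟F ⊥′       = no λ ()
(_ ∧′ _) ≟F (_ ∨′ _) = no λ ()
(_ ∧′ _) ≟F (_ ⊃ _)  = no λ ()
(_ ⊃ _) ≟F atom _    = no λ ()
(_ ⊃ _) ≟F ⊥′        = no λ ()
(_ ⊃ _) ≟F (_ ∨′ _)  = no λ ()
(_ ⊃ _) ≟F (_ ∧′ _)  = no λ ()

open import Data.List.Membership.DecPropositional _≟F_ using (_∈?_)

module _ {A : Set} where

  -- All subsequences of a list; every filter of xs is among them, which makes
  -- the sequents over a finite set enumerable up to ⊆.
  subsequences : List A → List (List A)
  subsequences []       = [] ∷ []
  subsequences (x ∷ xs) = map (x ∷_) (subsequences xs) ++ subsequences xs

  filter∈subsequences : {P : A → Set} (P? : Decidable P) (xs : List A) →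
                        filter P? xs ∈ subsequences xs
  filter∈subsequences P? []       = here refl
  filter∈subsequences P? (x ∷ xs) with does (P? x)
  ... | true  = ∈-++⁺ˡ (∈-map⁺ (x ∷_) (filter∈subsequences P? xs))
  ... | false = ∈-++⁺ʳ (map (x ∷_) (subsequences xs)) (filter∈subsequences P? xs)

  singleton⊆ : ∀ {x : A} {zs} → x ∈ zs → x ∷ [] ⊆ zs
  singleton⊆ x∈zs = ∈-∷⁺ʳ x∈zs λ ()

  ++-⊆ : ∀ {xs ys zs : List A} → xs ⊆ zs → ys ⊆ zs → xs ++ ys ⊆ zs
  ++-⊆ {xs} xs⊆ ys⊆ = [ xs⊆ , ys⊆ ] ∘ ∈-++⁻ xs

  count : {P : A → Set} → Decidable P → List A → ℕ
  count P? []       = 0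
  count P? (x ∷ xs) with P? x
  ... | yes _ = suc (count P? xs)
  ... | no _  = count P? xs

  count≤length : {P : A → Set} (P? : Decidable P) (xs : List A) → count P? xs ≤ length xs
  count≤length P? []       = z≤n
  count≤length P? (x ∷ xs) with P? x
  ... | yes _ = s≤s (count≤length P? xs)
  ... | no _  = m≤n⇒m≤1+n (count≤length P? xs)

  module _ {P Q : A → Set} (P? : Decidable P) (Q? : Decidable Q)
           (P⇒Q : ∀ {x} → P x → Q x) where

    count-mono : (xs : List A) → count P? xs ≤ count Q? xs
    count-mono []       = z≤n
    count-mono (x ∷ xs) with P? x | Q? x
    ... | yes _  | yes _  = s≤s (count-mono xs)
    ... | yes px | no ¬qx = ⊥-elim (¬qx (P⇒Q px))
    ... | no _   | yes _  = m≤n⇒m≤1+n (count-mono xs)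
    ... | no _   | no _   = count-mono xs

    count-strict : ∀ {y} (xs : List A) → y ∈ xs → ¬ P y → Q y →
                   count P? xs < count Q? xs
    count-strict (x ∷ xs) (here refl) ¬py qy with P? x | Q? x
    ... | yes py | _      = ⊥-elim (¬py py)
    ... | no _   | yes _  = s≤s (count-mono xs)
    ... | no _   | no ¬qy = ⊥-elim (¬qy qy)
    count-strict (x ∷ xs) (there y∈xs) ¬py qy with P? x | Q? x
    ... | yes _  | yes _  = s≤s (count-strict xs y∈xs ¬py qy)
    ... | yes px | no ¬qx = ⊥-elim (¬qx (P⇒Q px))
    ... | no _   | yes _  = m≤n⇒m≤1+n (count-strict xs y∈xs ¬py qy)
    ... | no _   | no _   = count-strict xs y∈xs ¬py qy

  module _ (P : ℕ → A → Set) (P? : ∀ h → Decidable (P h))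
           (P-step : ∀ h {x} → P h x → P (suc h) x) (xs : List A) where

    StableAt : ℕ → Set
    StableAt h = All (λ x → P (suc h) x → P h x) xs

    StableAt? : ∀ h → Dec (StableAt h)
    StableAt? h = all? (λ x → P? (suc h) x →-dec P? h x) xs

    newcomer : ∀ h → ¬ StableAt h → Σ A λ x → x ∈ xs × P (suc h) x × ¬ P h x
    newcomer h unstable with find (¬All⇒Any¬ (λ x → P? (suc h) x →-dec P? h x) xs unstable)
    ... | x , x∈xs , ¬step with P? (suc h) x | P? h x
    ...   | _        | yes ph = ⊥-elim (¬step (λ _ → ph))
    ...   | no ¬psh  | no _   = ⊥-elim (¬step (⊥-elim ∘ ¬psh))
    ...   | yes psh  | no ¬ph = x , x∈xs , psh , ¬ph

    growth : ∀ k → Σ ℕ StableAt ⊎ k ≤ count (P? k) xs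
    growth zero = inj₂ z≤n
    growth (suc k) with growth k | StableAt? k
    ... | inj₁ stable | _          = inj₁ stable
    ... | inj₂ _      | yes stable = inj₁ (k , stable)
    ... | inj₂ k≤     | no unstable =
      let x , x∈xs , psk , ¬pk = newcomer k unstable
      in inj₂ (≤-<-trans k≤ (count-strict (P? k) (P? (suc k)) (P-step k) xs x∈xs ¬pk psk))

    stabilises : Σ ℕ StableAt
    stabilises with growth (suc (length xs))
    ... | inj₁ stable = stable
    ... | inj₂ tooMany = ⊥-elim (1+n≰n (≤-trans tooMany (count≤length (P? _) xs)))

children : Formula → List Formula
children (atom _) = []
children ⊥′       = []
children (α ∨′ β) = α ∷ β ∷ []
children (α ∧′ β) = α ∷ β ∷ []
children (α ⊃ β)  = α ∷ β ∷ []

Closed : Cedent → Set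
Closed S = ∀ {φ ψ} → φ ∈ S → ψ ∈ children φ → ψ ∈ S

subformulas : Formula → List Formula
subformulas (atom p) = atom p ∷ []
subformulas ⊥′       = ⊥′ ∷ []
subformulas (α ∨′ β) = (α ∨′ β) ∷ subformulas α ++ subformulas β
subformulas (α ∧′ β) = (α ∧′ β) ∷ subformulas α ++ subformulas β
subformulas (α ⊃ β)  = (α ⊃ β) ∷ subformulas α ++ subformulas β

subformulas-self : ∀ φ → φ ∈ subformulas φ
subformulas-self (atom p) = here refl
subformulas-self ⊥′       = here refl
subformulas-self (α ∨′ β) = here refl
subformulas-self (α ∧′ β) = here refl
subformulas-self (α ⊃ β)  = here refl

subformulas-closed : ∀ φ → Closed (subformulas φ)

compound-closed : ∀ φ α β → children φ ≡ α ∷ β ∷ [] →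
                  Closed (φ ∷ subformulas α ++ subformulas β)
compound-closed φ α β eq (here refl) ψ∈ with subst (_ ∈_) eq ψ∈
... | here refl         = there (∈-++⁺ˡ (subformulas-self α))
... | there (here refl) = there (∈-++⁺ʳ (subformulas α) (subformulas-self β))
compound-closed φ α β eq (there χ∈) ψ∈ with ∈-++⁻ (subformulas α) χ∈
... | inj₁ χ∈α = there (∈-++⁺ˡ (subformulas-closed α χ∈α ψ∈))
... | inj₂ χ∈β = there (∈-++⁺ʳ (subformulas α) (subformulas-closed β χ∈β ψ∈))

subformulas-closed (atom p) (here refl) ()
subformulas-closed ⊥′       (here refl) ()
subformulas-closed (α ∨′ β) = compound-closed (α ∨′ β) α β refl
subformulas-closed (α ∧′ β) = compound-closed (α ∧′ β) α β refl
subformulas-closed (α ⊃ β)  = compound-closed (α ⊃ β) α β refl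

closure : Cedent → Cedent
closure []      = []
closure (φ ∷ Γ) = subformulas φ ++ closure Γ

closure-closed : ∀ Γ → Closed (closure Γ)
closure-closed (φ ∷ Γ) χ∈ ψ∈ with ∈-++⁻ (subformulas φ) χ∈
... | inj₁ χ∈φ = ∈-++⁺ˡ (subformulas-closed φ χ∈φ ψ∈)
... | inj₂ χ∈Γ = ∈-++⁺ʳ (subformulas φ) (closure-closed Γ χ∈Γ ψ∈)

closure-⊇ : ∀ Γ → Γ ⊆ closure Γ
closure-⊇ (φ ∷ Γ) (here refl) = ∈-++⁺ˡ (subformulas-self φ)
closure-⊇ (φ ∷ Γ) (there ψ∈)  = ∈-++⁺ʳ (subformulas φ) (closure-⊇ Γ ψ∈)

module _ (M : KripkeModel) where
  open KripkeModel M

  persistent : ∀ φ {σ τ} → σ ≼ τ → _⊩_ M σ φ → _⊩_ M τ φ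
  persistent (atom p) σ≼τ f       = V-mono σ≼τ f
  persistent ⊥′       σ≼τ ()
  persistent (α ∨′ β) σ≼τ (inj₁ a) = inj₁ (persistent α σ≼τ a)
  persistent (α ∨′ β) σ≼τ (inj₂ b) = inj₂ (persistent β σ≼τ b)
  persistent (α ∧′ β) σ≼τ (a , b)  = persistent α σ≼τ a , persistent β σ≼τ b
  persistent (α ⊃ β)  σ≼τ f        = λ υ τ≼υ → f υ (≼-trans σ≼τ τ≼υ)

  -- Each rule preserves truth at a world; ⊃R uses persistence of Γ.
  sound-at : ∀ {Γ Δ} → Γ ⇒ Δ → ∀ σ → All (_⊩_ M σ) Γ → Any (_⊩_ M σ) Δ
  sound-at (ax p p∈Γ p∈Δ) σ γ = lose p∈Δ (All.lookup γ p∈Γ)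
  sound-at (⊥ax ⊥∈Γ)      σ γ = ⊥-elim (All.lookup γ ⊥∈Γ)
  sound-at (∨L m d₀ d₁)   σ γ with All.lookup γ m
  ... | inj₁ a = sound-at d₀ σ (a ∷ γ)
  ... | inj₂ b = sound-at d₁ σ (b ∷ γ)
  sound-at (∨R m d)       σ γ with sound-at d σ γ
  ... | here a           = lose m (inj₁ a)
  ... | there (here b)   = lose m (inj₂ b)
  ... | there (there δ)  = δ
  sound-at (∧L m d)       σ γ with All.lookup γ m
  ... | a , b = sound-at d σ (a ∷ b ∷ γ)
  sound-at (∧R m d₀ d₁)   σ γ with sound-at d₀ σ γ | sound-at d₁ σ γ
  ... | there δ | _       = δ
  ... | here _  | there δ = δ
  ... | here a  | here b  = lose m (a , b)
  sound-at (⊃L m d₀ d₁)   σ γ with sound-at d₀ σ γ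
  ... | there δ = δ
  ... | here a  = sound-at d₁ σ (All.lookup γ m σ ≼-refl a ∷ γ)
  sound-at (⊃R m d)       σ γ = lose m λ τ σ≼τ a →
    single (sound-at d τ (a ∷ All.map (λ {φ} → persistent φ σ≼τ) γ))
    where
      single : ∀ {τ ψ} → Any (_⊩_ M τ) (ψ ∷ []) → _⊩_ M τ ψ
      single (here f) = f

sound : ∀ {Γ Δ} → Γ ⇒ Δ → Valid Γ Δ
sound d M = sound-at M d

Rel : Set₁
Rel = Cedent → Cedent → Set

Axiomatic : Formula → Cedent → Set
Axiomatic (atom p) Δ = atom p ∈ Δ
Axiomatic ⊥′       Δ = ⊤
Axiomatic _        Δ = ⊥

LeftPremises : Rel → Formula → Rel
LeftPremises R (α ∨′ β) Γ Δ = R (α ∷ Γ) Δ × R (β ∷ Γ) Δ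
LeftPremises R (α ∧′ β) Γ Δ = R (α ∷ β ∷ Γ) Δ
LeftPremises R (α ⊃ β)  Γ Δ = R Γ (α ∷ Δ) × R (β ∷ Γ) Δ
LeftPremises R _        Γ Δ = ⊥

RightPremises : Rel → Formula → Rel
RightPremises R (α ∨′ β) Γ Δ = R Γ (α ∷ β ∷ Δ)
RightPremises R (α ∧′ β) Γ Δ = R Γ (α ∷ Δ) × R Γ (β ∷ Δ)
RightPremises R (α ⊃ β)  Γ Δ = R (α ∷ Γ) (β ∷ [])
RightPremises R _        Γ Δ = ⊥

Step : Rel → Rel
Step R Γ Δ = Any (λ φ → Axiomatic φ Δ) Γ
           ⊎ Any (λ φ → LeftPremises R φ Γ Δ) Γ
           ⊎ Any (λ φ → RightPremises R φ Γ Δ) Δ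

Deriv : ℕ → Rel
Deriv zero    Γ Δ = ⊥
Deriv (suc h) Γ Δ = Step (Deriv h) Γ Δ

_⊆ᴿ_ : Rel → Rel → Set
R ⊆ᴿ R′ = ∀ {Γ Δ} → R Γ Δ → R′ Γ Δ

Step-map : ∀ {R R′} → R ⊆ᴿ R′ → Step R ⊆ᴿ Step R′
Step-map {R} {R′} f = [ inj₁ , [ inj₂ ∘ inj₁ ∘ Any.map (λ {φ} → left φ)
                                , inj₂ ∘ inj₂ ∘ Any.map (λ {φ} → right φ) ] ]
  where
    left : ∀ φ {Γ Δ} → LeftPremises R φ Γ Δ → LeftPremises R′ φ Γ Δ
    left (α ∨′ β) (d₀ , d₁) = f d₀ , f d₁
    left (α ∧′ β) d         = f d
    left (α ⊃ β)  (d₀ , d₁) = f d₀ , f d₁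
    right : ∀ φ {Γ Δ} → RightPremises R φ Γ Δ → RightPremises R′ φ Γ Δ
    right (α ∨′ β) d         = f d
    right (α ∧′ β) (d₀ , d₁) = f d₀ , f d₁
    right (α ⊃ β)  d         = f d

Deriv-mono : ∀ {h h′} → h ≤ h′ → Deriv h ⊆ᴿ Deriv h′
Deriv-mono {suc h} {suc h′} (s≤s h≤h′) = Step-map (Deriv-mono h≤h′)

Deriv-step : ∀ h → Deriv h ⊆ᴿ Deriv (suc h)
Deriv-step h = Deriv-mono (n≤1+n h)

DecRel : Rel → Set
DecRel R = ∀ Γ Δ → Dec (R Γ Δ)

-- Step preserves decidability: a cedent offers finitely many rule instances.
Step-dec : ∀ {R} → DecRel R → DecRel (Step R)
Step-dec {R} R? Γ Δ = any? (λ φ → axiomatic? φ) Γ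
                  ⊎-dec any? (λ φ → left? φ) Γ
                  ⊎-dec any? (λ φ → right? φ) Δ
  where
    axiomatic? : ∀ φ → Dec (Axiomatic φ Δ)
    axiomatic? (atom p) = atom p ∈? Δ
    axiomatic? ⊥′       = yes tt
    axiomatic? (_ ∨′ _) = no λ ()
    axiomatic? (_ ∧′ _) = no λ ()
    axiomatic? (_ ⊃ _)  = no λ ()
    left? : ∀ φ → Dec (LeftPremises R φ Γ Δ)
    left? (atom _) = no λ ()
    left? ⊥′       = no λ ()
    left? (α ∨′ β) = R? _ _ ×-dec R? _ _
    left? (α ∧′ β) = R? _ _
    left? (α ⊃ β)  = R? _ _ ×-dec R? _ _
    right? : ∀ φ → Dec (RightPremises R φ Γ Δ)
    right? (atom _) = no λ ()
    right? ⊥′       = no λ ()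
    right? (α ∨′ β) = R? _ _
    right? (α ∧′ β) = R? _ _ ×-dec R? _ _
    right? (α ⊃ β)  = R? _ _

Deriv-dec : ∀ h → DecRel (Deriv h)
Deriv-dec zero    Γ Δ = no λ ()
Deriv-dec (suc h)     = Step-dec (Deriv-dec h)

Weakenable : Rel → Set
Weakenable R = ∀ {Γ Γ′ Δ Δ′} → Γ ⊆ Γ′ → Δ ⊆ Δ′ → R Γ Δ → R Γ′ Δ′

Step-weaken : ∀ {R} → Weakenable R → Weakenable (Step R)
Step-weaken {R} wk {Γ} {Γ′} {Δ} {Δ′} Γ⊆ Δ⊆ =
  [ inj₁ ∘ Any-resp-⊆ Γ⊆ ∘ Any.map (λ {φ} → axiomatic φ)
  , [ inj₂ ∘ inj₁ ∘ Any-resp-⊆ Γ⊆ ∘ Any.map (λ {φ} → left φ)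
    , inj₂ ∘ inj₂ ∘ Any-resp-⊆ Δ⊆ ∘ Any.map (λ {φ} → right φ) ] ]
  where
    axiomatic : ∀ φ → Axiomatic φ Δ → Axiomatic φ Δ′
    axiomatic (atom p) p∈ = Δ⊆ p∈
    axiomatic ⊥′       _  = tt
    left : ∀ φ → LeftPremises R φ Γ Δ → LeftPremises R φ Γ′ Δ′
    left (α ∨′ β) (d₀ , d₁) = wk (∷⁺ʳ α Γ⊆) Δ⊆ d₀ , wk (∷⁺ʳ β Γ⊆) Δ⊆ d₁
    left (α ∧′ β) d         = wk (∷⁺ʳ α (∷⁺ʳ β Γ⊆)) Δ⊆ d
    left (α ⊃ β)  (d₀ , d₁) = wk Γ⊆ (∷⁺ʳ α Δ⊆) d₀ , wk (∷⁺ʳ β Γ⊆) Δ⊆ d₁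
    right : ∀ φ → RightPremises R φ Γ Δ → RightPremises R φ Γ′ Δ′
    right (α ∨′ β) d         = wk Γ⊆ (∷⁺ʳ α (∷⁺ʳ β Δ⊆)) d
    right (α ∧′ β) (d₀ , d₁) = wk Γ⊆ (∷⁺ʳ α Δ⊆) d₀ , wk Γ⊆ (∷⁺ʳ β Δ⊆) d₁
    right (α ⊃ β)  d         = wk (∷⁺ʳ α Γ⊆) ⊆-refl d

Deriv-weaken : ∀ h → Weakenable (Deriv h)
Deriv-weaken (suc h) = Step-weaken (Deriv-weaken h)

Step-sound : ∀ {R} → R ⊆ᴿ _⇒_ → Step R ⊆ᴿ _⇒_
Step-sound f (inj₁ axm) with find axm
... | atom p , p∈Γ , p∈Δ = ax p p∈Γ p∈Δ
... | ⊥′     , ⊥∈Γ , _   = ⊥ax ⊥∈Γ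
Step-sound f (inj₂ (inj₁ lft)) with find lft
... | (α ∨′ β) , m , d₀ , d₁ = ∨L m (f d₀) (f d₁)
... | (α ∧′ β) , m , d       = ∧L m (f d)
... | (α ⊃ β)  , m , d₀ , d₁ = ⊃L m (f d₀) (f d₁)
Step-sound f (inj₂ (inj₂ rgt)) with find rgt
... | (α ∨′ β) , m , d       = ∨R m (f d)
... | (α ∧′ β) , m , d₀ , d₁ = ∧R m (f d₀) (f d₁)
... | (α ⊃ β)  , m , d       = ⊃R m (f d)

Deriv-sound : ∀ h → Deriv h ⊆ᴿ _⇒_
Deriv-sound (suc h) = Step-sound (Deriv-sound h)

Height : Rel
Height Γ Δ = Σ ℕ λ h → Deriv h Γ Δ

module _ {Γ Δ : Cedent} where
  byAxiom : ∀ φ → φ ∈ Γ → Axiomatic φ Δ → Height Γ Δ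
  byAxiom φ m a = 1 , inj₁ (lose m a)

  byLeft₁ : ∀ φ {Γ₀ Δ₀} → φ ∈ Γ → (∀ {R} → R Γ₀ Δ₀ → LeftPremises R φ Γ Δ) →
            Height Γ₀ Δ₀ → Height Γ Δ
  byLeft₁ φ m rule (h , d) = suc h , inj₂ (inj₁ (lose m (rule d)))

  byRight₁ : ∀ φ {Γ₀ Δ₀} → φ ∈ Δ → (∀ {R} → R Γ₀ Δ₀ → RightPremises R φ Γ Δ) →
             Height Γ₀ Δ₀ → Height Γ Δ
  byRight₁ φ m rule (h , d) = suc h , inj₂ (inj₂ (lose m (rule d)))

  byLeft₂ : ∀ φ {Γ₀ Δ₀ Γ₁ Δ₁} → φ ∈ Γ →
            (∀ {R} → R Γ₀ Δ₀ → R Γ₁ Δ₁ → LeftPremises R φ Γ Δ) →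
            Height Γ₀ Δ₀ → Height Γ₁ Δ₁ → Height Γ Δ
  byLeft₂ φ m rule (h₀ , d₀) (h₁ , d₁) = suc (h₀ ⊔ h₁) , inj₂ (inj₁ (lose m
    (rule (Deriv-mono (m≤m⊔n h₀ h₁) d₀) (Deriv-mono (m≤n⊔m h₀ h₁) d₁))))

  byRight₂ : ∀ φ {Γ₀ Δ₀ Γ₁ Δ₁} → φ ∈ Δ →
             (∀ {R} → R Γ₀ Δ₀ → R Γ₁ Δ₁ → RightPremises R φ Γ Δ) →
             Height Γ₀ Δ₀ → Height Γ₁ Δ₁ → Height Γ Δ
  byRight₂ φ m rule (h₀ , d₀) (h₁ , d₁) = suc (h₀ ⊔ h₁) , inj₂ (inj₂ (lose m
    (rule (Deriv-mono (m≤m⊔n h₀ h₁) d₀) (Deriv-mono (m≤n⊔m h₀ h₁) d₁))))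

height : ∀ {Γ Δ} → Γ ⇒ Δ → Height Γ Δ
height (ax p p∈Γ p∈Δ) = byAxiom (atom p) p∈Γ p∈Δ
height (⊥ax ⊥∈Γ)      = byAxiom ⊥′ ⊥∈Γ tt
height (∨L m d₀ d₁)   = byLeft₂ _ m _,_ (height d₀) (height d₁)
height (∧L m d)       = byLeft₁ _ m (λ d → d) (height d)
height (⊃L m d₀ d₁)   = byLeft₂ _ m _,_ (height d₀) (height d₁)
height (∨R m d)       = byRight₁ _ m (λ d → d) (height d)
height (∧R m d₀ d₁)   = byRight₂ _ m _,_ (height d₀) (height d₁)
height (⊃R m d)       = byRight₁ _ m (λ d → d) (height d)

module Decision (S : Cedent) (closed : Closed S) where

  Within : Rel → Rel
  Within R Γ Δ = Γ ⊆ S → Δ ⊆ S → R Γ Δ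

  left-within : ∀ {R Γ Δ} φ → children φ ⊆ S → Γ ⊆ S → Δ ⊆ S →
                LeftPremises (Within R) φ Γ Δ → LeftPremises R φ Γ Δ
  left-within (α ∨′ β) cs ΓS ΔS (d₀ , d₁) =
    d₀ (∈-∷⁺ʳ (cs (here refl)) ΓS) ΔS , d₁ (∈-∷⁺ʳ (cs (there (here refl))) ΓS) ΔS
  left-within (α ∧′ β) cs ΓS ΔS d = d (++-⊆ cs ΓS) ΔS
  left-within (α ⊃ β)  cs ΓS ΔS (d₀ , d₁) =
    d₀ ΓS (∈-∷⁺ʳ (cs (here refl)) ΔS) , d₁ (∈-∷⁺ʳ (cs (there (here refl))) ΓS) ΔS

  right-within : ∀ {R Γ Δ} φ → children φ ⊆ S → Γ ⊆ S → Δ ⊆ S →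
                 RightPremises (Within R) φ Γ Δ → RightPremises R φ Γ Δ
  right-within (α ∨′ β) cs ΓS ΔS d = d ΓS (++-⊆ cs ΔS)
  right-within (α ∧′ β) cs ΓS ΔS (d₀ , d₁) =
    d₀ ΓS (∈-∷⁺ʳ (cs (here refl)) ΔS) , d₁ ΓS (∈-∷⁺ʳ (cs (there (here refl))) ΔS)
  right-within (α ⊃ β)  cs ΓS ΔS d =
    d (∈-∷⁺ʳ (cs (here refl)) ΓS) (singleton⊆ (cs (there (here refl))))

  Step-within : ∀ {R Γ Δ} → Γ ⊆ S → Δ ⊆ S → Step (Within R) Γ Δ → Step R Γ Δ
  Step-within ΓS ΔS (inj₁ axm) = inj₁ axm
  Step-within ΓS ΔS (inj₂ (inj₁ lft)) with find lft
  ... | φ , m , d = inj₂ (inj₁ (lose m (left-within φ (closed (ΓS m)) ΓS ΔS d)))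
  Step-within ΓS ΔS (inj₂ (inj₂ rgt)) with find rgt
  ... | φ , m , d = inj₂ (inj₂ (lose m (right-within φ (closed (ΔS m)) ΓS ΔS d)))

  -- Up to ⊆, a cedent over S is represented by the sublist of S it contains;
  -- the representatives form the finite list  candidates.
  represent : Cedent → Cedent
  represent Γ = filter (_∈? Γ) S

  represent-⊆ : ∀ {Γ} → represent Γ ⊆ Γ
  represent-⊆ {Γ} m = proj₂ (∈-filter⁻ (_∈? Γ) {xs = S} m)

  ⊆-represent : ∀ {Γ} → Γ ⊆ S → Γ ⊆ represent Γ
  ⊆-represent {Γ} ΓS m = ∈-filter⁺ (_∈? Γ) (ΓS m) m

  candidates : List (Cedent × Cedent)
  candidates = cartesianProduct (subsequences S) (subsequences S)

  represent∈candidates : ∀ Γ Δ → (represent Γ , represent Δ) ∈ candidates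
  represent∈candidates Γ Δ =
    ∈-cartesianProduct⁺ (filter∈subsequences (_∈? Γ) S) (filter∈subsequences (_∈? Δ) S)

  -- The height levels stabilise on the candidates at some level H …
  DerivSeq : ℕ → Cedent × Cedent → Set
  DerivSeq h (Γ , Δ) = Deriv h Γ Δ

  DerivSeq? : ∀ h → Decidable (DerivSeq h)
  DerivSeq? h (Γ , Δ) = Deriv-dec h Γ Δ

  DerivSeq-step : ∀ h {s} → DerivSeq h s → DerivSeq (suc h) s
  DerivSeq-step h {Γ , Δ} = Deriv-step h

  stable : Σ ℕ (StableAt DerivSeq DerivSeq? DerivSeq-step candidates)
  stable = stabilises DerivSeq DerivSeq? DerivSeq-step candidates

  H : ℕ
  H = proj₁ stable

  -- … hence on all sequents over S, by weakening to and from representatives …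
  collapse : ∀ {Γ Δ} → Γ ⊆ S → Δ ⊆ S → Deriv (suc H) Γ Δ → Deriv H Γ Δ
  collapse {Γ} {Δ} ΓS ΔS d =
    Deriv-weaken H represent-⊆ represent-⊆
      (All.lookup (proj₂ stable) (represent∈candidates Γ Δ)
        (Deriv-weaken (suc H) (⊆-represent ΓS) (⊆-represent ΔS) d))

  bounded : ∀ h → Deriv h ⊆ᴿ Within (Deriv H)
  bounded (suc h) d ΓS ΔS = collapse ΓS ΔS (Step-within ΓS ΔS (Step-map (bounded h) d))

  ⇒-dec : ∀ {Γ Δ} → Γ ⊆ S → Δ ⊆ S → Dec (Γ ⇒ Δ)
  ⇒-dec {Γ} {Δ} ΓS ΔS with Deriv-dec H Γ Δ
  ... | yes d  = yes (Deriv-sound H d)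
  ... | no ¬d  = no λ d → let h , dₕ = height d in ¬d (bounded h dₕ ΓS ΔS)

-- A compound formula of the antecedent (succedent) is satisfied when the
-- formulas of one premise of its left (right) rule are already present.
SatL : Cedent → Cedent → Formula → Set
SatL Γ Δ (α ∨′ β) = α ∈ Γ ⊎ β ∈ Γ
SatL Γ Δ (α ∧′ β) = α ∈ Γ × β ∈ Γ
SatL Γ Δ (α ⊃ β)  = α ∈ Δ ⊎ β ∈ Γ
SatL Γ Δ _        = ⊤

SatR : Cedent → Formula → Set
SatR Δ (α ∨′ β) = α ∈ Δ × β ∈ Δ
SatR Δ (α ∧′ β) = α ∈ Δ ⊎ β ∈ Δ
SatR Δ _        = ⊤

SatL? : ∀ Γ Δ → Decidable (SatL Γ Δ)
SatL? Γ Δ (α ∨′ β) = (α ∈? Γ) ⊎-dec (β ∈? Γ)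
SatL? Γ Δ (α ∧′ β) = (α ∈? Γ) ×-dec (β ∈? Γ)
SatL? Γ Δ (α ⊃ β)  = (α ∈? Δ) ⊎-dec (β ∈? Γ)
SatL? Γ Δ (atom _) = yes tt
SatL? Γ Δ ⊥′       = yes tt

SatR? : ∀ Δ → Decidable (SatR Δ)
SatR? Δ (α ∨′ β) = (α ∈? Δ) ×-dec (β ∈? Δ)
SatR? Δ (α ∧′ β) = (α ∈? Δ) ⊎-dec (β ∈? Δ)
SatR? Δ (α ⊃ β)  = yes tt
SatR? Δ (atom _) = yes tt
SatR? Δ ⊥′       = yes tt

Saturated : Cedent → Cedent → Set
Saturated Γ Δ = All (SatL Γ Δ) Γ × All (SatR Δ) Δ

oneFails : {A B C : Set} → Dec A → Dec B → (A → B → C) → ¬ C → ¬ A ⊎ ¬ B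
oneFails (no ¬a)  _       _    _  = inj₁ ¬a
oneFails (yes _)  (no ¬b) _    _  = inj₂ ¬b
oneFails (yes a)  (yes b) rule ¬c = ⊥-elim (¬c (rule a b))

someMissing : ∀ {α β Γ} → ¬ (α ∈ Γ × β ∈ Γ) → Any (_∉ Γ) (α ∷ β ∷ [])
someMissing {α} {β} {Γ} ¬both with α ∈? Γ
... | no α∉Γ = here α∉Γ
... | yes α∈Γ = there (here λ β∈Γ → ¬both (α∈Γ , β∈Γ))

module Canonical (S : Cedent) (closed : Closed S)
                 (⇒-dec : ∀ {Γ Δ} → Γ ⊆ S → Δ ⊆ S → Dec (Γ ⇒ Δ)) where

  -- Termination measure: the number of formulas of S missing from Γ and Δ.
  missing : Cedent → ℕ
  missing Γ = count (λ x → ¬? (x ∈? Γ)) S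

  μ : Cedent → Cedent → ℕ
  μ Γ Δ = missing Γ + missing Δ

  missing-add : ∀ {Γ} Θ → Θ ⊆ S → Any (_∉ Γ) Θ → missing (Θ ++ Γ) < missing Γ
  missing-add {Γ} Θ ΘS new with find new
  ... | x , x∈Θ , x∉Γ =
    count-strict (λ y → ¬? (y ∈? Θ ++ Γ)) (λ y → ¬? (y ∈? Γ))
                 (λ y∉ → y∉ ∘ xs⊆ys++xs Γ Θ) S (ΘS x∈Θ) (λ x∉ → x∉ (∈-++⁺ˡ x∈Θ)) x∉Γ

  record Extension (Γ Δ : Cedent) : Set where
    field
      Γ′ Δ′       : Cedent
      Γ⊆Γ′        : Γ ⊆ Γ′
      Δ⊆Δ′        : Δ ⊆ Δ′
      Γ′⊆S        : Γ′ ⊆ S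
      Δ′⊆S        : Δ′ ⊆ S
      underivable : ¬ (Γ′ ⇒ Δ′)
      smaller     : μ Γ′ Δ′ < μ Γ Δ

  module _ {Γ Δ} (ΓS : Γ ⊆ S) (ΔS : Δ ⊆ S) where

    extendL : ∀ Θ → Θ ⊆ S → Any (_∉ Γ) Θ → ¬ (Θ ++ Γ ⇒ Δ) → Extension Γ Δ
    extendL Θ ΘS new u = record
      { Γ′ = Θ ++ Γ ; Δ′ = Δ ; Γ⊆Γ′ = xs⊆ys++xs Γ Θ ; Δ⊆Δ′ = ⊆-refl
      ; Γ′⊆S = ++-⊆ ΘS ΓS ; Δ′⊆S = ΔS ; underivable = u
      ; smaller = +-mono-<-≤ (missing-add Θ ΘS new) ≤-refl }

    extendR : ∀ Θ → Θ ⊆ S → Any (_∉ Δ) Θ → ¬ (Γ ⇒ Θ ++ Δ) → Extension Γ Δ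
    extendR Θ ΘS new u = record
      { Γ′ = Γ ; Δ′ = Θ ++ Δ ; Γ⊆Γ′ = ⊆-refl ; Δ⊆Δ′ = xs⊆ys++xs Δ Θ
      ; Γ′⊆S = ΓS ; Δ′⊆S = ++-⊆ ΘS ΔS ; underivable = u
      ; smaller = +-mono-≤-< (≤-refl {missing Γ}) (missing-add Θ ΘS new) }

    -- An unsatisfied formula of the antecedent yields an extension: some
    -- premise of its rule is underivable and contributes a new formula.
    unsatL : ∀ {φ} → φ ∈ Γ → ¬ SatL Γ Δ φ → ¬ (Γ ⇒ Δ) → Extension Γ Δ
    unsatL {atom _} _ unsat _ = ⊥-elim (unsat tt)
    unsatL {⊥′}     _ unsat _ = ⊥-elim (unsat tt)
    unsatL {α ∨′ β} m unsat u =
      [ extendL (α ∷ []) (singleton⊆ α∈S) (here (unsat ∘ inj₁))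
      , extendL (β ∷ []) (singleton⊆ β∈S) (here (unsat ∘ inj₂)) ]
      (oneFails (⇒-dec (∈-∷⁺ʳ α∈S ΓS) ΔS) (⇒-dec (∈-∷⁺ʳ β∈S ΓS) ΔS) (∨L m) u)
      where α∈S = closed (ΓS m) (here refl)
            β∈S = closed (ΓS m) (there (here refl))
    unsatL {α ∧′ β} m unsat u =
      extendL (α ∷ β ∷ []) (closed (ΓS m)) (someMissing unsat) (u ∘ ∧L m)
    unsatL {α ⊃ β}  m unsat u =
      [ extendR (α ∷ []) (singleton⊆ α∈S) (here (unsat ∘ inj₁))
      , extendL (β ∷ []) (singleton⊆ β∈S) (here (unsat ∘ inj₂)) ]
      (oneFails (⇒-dec ΓS (∈-∷⁺ʳ α∈S ΔS)) (⇒-dec (∈-∷⁺ʳ β∈S ΓS) ΔS) (⊃L m) u)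
      where α∈S = closed (ΓS m) (here refl)
            β∈S = closed (ΓS m) (there (here refl))

    unsatR : ∀ {φ} → φ ∈ Δ → ¬ SatR Δ φ → ¬ (Γ ⇒ Δ) → Extension Γ Δ
    unsatR {atom _} _ unsat _ = ⊥-elim (unsat tt)
    unsatR {⊥′}     _ unsat _ = ⊥-elim (unsat tt)
    unsatR {_ ⊃ _}  _ unsat _ = ⊥-elim (unsat tt)
    unsatR {α ∨′ β} m unsat u =
      extendR (α ∷ β ∷ []) (closed (ΔS m)) (someMissing unsat) (u ∘ ∨R m)
    unsatR {α ∧′ β} m unsat u =
      [ extendR (α ∷ []) (singleton⊆ α∈S) (here (unsat ∘ inj₁))
      , extendR (β ∷ []) (singleton⊆ β∈S) (here (unsat ∘ inj₂)) ]
      (oneFails (⇒-dec ΓS (∈-∷⁺ʳ α∈S ΔS)) (⇒-dec ΓS (∈-∷⁺ʳ β∈S ΔS)) (∧R m) u)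
      where α∈S = closed (ΔS m) (here refl)
            β∈S = closed (ΔS m) (there (here refl))

    refine : ¬ (Γ ⇒ Δ) → Saturated Γ Δ ⊎ Extension Γ Δ
    refine u with all? (SatL? Γ Δ) Γ
    ... | no ¬satL = inj₂ (let _ , m , unsat = find (¬All⇒Any¬ (SatL? Γ Δ) Γ ¬satL)
                           in unsatL m unsat u)
    ... | yes satL with all? (SatR? Δ) Δ
    ...   | no ¬satR = inj₂ (let _ , m , unsat = find (¬All⇒Any¬ (SatR? Δ) Δ ¬satR)
                             in unsatR m unsat u)
    ...   | yes satR = inj₁ (satL , satR)

  record World : Set where
    field
      Γ Δ         : Cedent
      Γ⊆S         : Γ ⊆ S
      Δ⊆S         : Δ ⊆ S
      saturated   : Saturated Γ Δ
      underivable : ¬ (Γ ⇒ Δ)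
  open World

  Saturation : Cedent → Cedent → Set
  Saturation Γ Δ = Σ World λ w → Γ ⊆ World.Γ w × Δ ⊆ World.Δ w

  -- Lindenbaum-style lemma: iterate  refine  until saturated (μ decreases).
  saturate : ∀ {Γ Δ} → Γ ⊆ S → Δ ⊆ S → ¬ (Γ ⇒ Δ) → Saturation Γ Δ
  saturate = go (<-wellFounded _)
    where
      go : ∀ {Γ Δ} → Acc _<_ (μ Γ Δ) → Γ ⊆ S → Δ ⊆ S → ¬ (Γ ⇒ Δ) → Saturation Γ Δ
      go {Γ} {Δ} (acc rec) ΓS ΔS u with refine ΓS ΔS u
      ... | inj₁ sat = record { Γ = Γ ; Δ = Δ ; Γ⊆S = ΓS ; Δ⊆S = ΔS
                              ; saturated = sat ; underivable = u } , ⊆-refl , ⊆-refl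
      ... | inj₂ e =
        let module E = Extension e
            w , Γ′⊆ , Δ′⊆ = go (rec E.smaller) E.Γ′⊆S E.Δ′⊆S E.underivable
        in w , ⊆-trans E.Γ⊆Γ′ Γ′⊆ , ⊆-trans E.Δ⊆Δ′ Δ′⊆

  satL : ∀ w {φ} → φ ∈ Γ w → SatL (Γ w) (Δ w) φ
  satL w = All.lookup (proj₁ (saturated w))

  satR : ∀ w {φ} → φ ∈ Δ w → SatR (Δ w) φ
  satR w = All.lookup (proj₂ (saturated w))

  -- For α ⊃ β ∈ Δ w the premise α, Γ w ⇒ β of ⊃R is underivable; saturating
  -- it gives a world above w containing α and refuting β.
  ⊃-witness : ∀ {α β} w → (α ⊃ β) ∈ Δ w → Σ World λ v → α ∷ Γ w ⊆ Γ v × β ∷ [] ⊆ Δ v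
  ⊃-witness {α} {β} w m = saturate (∈-∷⁺ʳ (children⊆S (here refl)) (Γ⊆S w))
                                   (singleton⊆ (children⊆S (there (here refl))))
                                   (underivable w ∘ ⊃R m)
    where children⊆S : α ∷ β ∷ [] ⊆ S
          children⊆S = closed (Δ⊆S w m)

  canonical : World → KripkeModel
  canonical w₀ = record
    { W = World ; inhabited = w₀
    ; _≼_ = λ w v → Γ w ⊆ Γ v ; ≼-refl = ⊆-refl ; ≼-trans = ⊆-trans
    ; V = λ w p → atom p ∈ Γ w ; V-mono = λ w⊆v p∈ → w⊆v p∈ }

  module Truth (w₀ : World) where
    _⊩ᶜ_ : World → Formula → Set
    _⊩ᶜ_ = _⊩_ (canonical w₀)

    forced  : ∀ φ w → φ ∈ Γ w → w ⊩ᶜ φ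
    refuted : ∀ φ w → φ ∈ Δ w → ¬ (w ⊩ᶜ φ)

    forced (atom p) w m = m
    forced ⊥′       w m = ⊥-elim (underivable w (⊥ax m))
    forced (α ∨′ β) w m with satL w m
    ... | inj₁ α∈ = inj₁ (forced α w α∈)
    ... | inj₂ β∈ = inj₂ (forced β w β∈)
    forced (α ∧′ β) w m with satL w m
    ... | α∈ , β∈ = forced α w α∈ , forced β w β∈
    forced (α ⊃ β)  w m v w⊆v ⊩α with satL v (w⊆v m)
    ... | inj₁ α∈Δ = ⊥-elim (refuted α v α∈Δ ⊩α)
    ... | inj₂ β∈Γ = forced β v β∈Γ

    refuted (atom p) w m p∈Γ = underivable w (ax p p∈Γ m)
    refuted ⊥′       w m ()
    refuted (α ∨′ β) w m (inj₁ ⊩α) = refuted α w (proj₁ (satR w m)) ⊩α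
    refuted (α ∨′ β) w m (inj₂ ⊩β) = refuted β w (proj₂ (satR w m)) ⊩β
    refuted (α ∧′ β) w m (⊩α , ⊩β) with satR w m
    ... | inj₁ α∈ = refuted α w α∈ ⊩α
    ... | inj₂ β∈ = refuted β w β∈ ⊩β
    refuted (α ⊃ β)  w m ⊩α⊃β =
      let v , αΓ⊆ , β⊆ = ⊃-witness w m
      in refuted β v (β⊆ (here refl)) (⊩α⊃β v (αΓ⊆ ∘ there) (forced α v (αΓ⊆ (here refl))))

  countermodel : ∀ {Γ Δ} → Γ ⊆ S → Δ ⊆ S → ¬ (Γ ⇒ Δ) → ¬ Valid Γ Δ
  countermodel ΓS ΔS u valid =
    let w , Γ⊆ , Δ⊆ = saturate ΓS ΔS u
        open Truth w
        φ , φ∈Δ , ⊩φ = find (valid (canonical w) w (All.tabulate λ m → forced _ w (Γ⊆ m)))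
    in refuted φ w (Δ⊆ φ∈Δ) ⊩φ

complete-within : ∀ S → Closed S → ∀ {Γ Δ} → Γ ⊆ S → Δ ⊆ S → Valid Γ Δ → Γ ⇒ Δ
complete-within S closed ΓS ΔS valid with Decision.⇒-dec S closed ΓS ΔS
... | yes d = d
... | no u  = ⊥-elim (Canonical.countermodel S closed (Decision.⇒-dec S closed) ΓS ΔS u valid)

completeness : (Γ Δ : Cedent) → Valid Γ Δ → Γ ⇒ Δ
completeness Γ Δ = complete-within (closure (Γ ++ Δ)) (closure-closed (Γ ++ Δ))
                     (closure-⊇ (Γ ++ Δ) ∘ ∈-++⁺ˡ) (closure-⊇ (Γ ++ Δ) ∘ ∈-++⁺ʳ Γ)

cut-valid : ∀ {Γ Δ α} → Γ ⇒ α ∷ Δ → α ∷ Γ ⇒ Δ → Valid Γ Δ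
cut-valid d₀ d₁ M σ γ with sound d₀ M σ γ
... | here ⊩α = sound d₁ M σ (⊩α ∷ γ)
... | there δ = δ

theorem1p5 : ((Γ Δ : Cedent) → Valid Γ Δ → Γ ⇒ Δ)
           × ((Γ Δ : Cedent) (α : Formula) → Γ ⇒ α ∷ Δ → α ∷ Γ ⇒ Δ → Γ ⇒ Δ)
theorem1p5 = completeness , λ Γ Δ α d₀ d₁ → completeness Γ Δ (cut-valid d₀ d₁)
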